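{- Let $P$ be a finite $N$-free ordered set which is not totally ordered, and suppose that every minimal element $x$ of $P$ is either maximal in $P$ or has an upper cover which is not minimal in $P\setminus\{x\}$. Then $P$ has two distinct minimal elements $m,m'$ such that $\{m,m'\}$ is autonomous in $P$.
   Context: In an ordered set, $x\prec y$ ($y$ is an upper cover of $x$) means $x<y$ and there is no $z$ with $x<z<y$. A 4-tuple $(a,b,c,d)$ of distinct elements is an $N$ if $a\prec b\succ c\prec d$ and $a,d$ are incomparable; $P$ is $N$-free if it contains no $N$. A subset $A$ of the ground set $V$ of $P$ is autonomous if for all $v\notin A$ and all $a,a'\in A$: $v<a$ implies $v<a'$, and $a<v$ implies $a'<v$. -}

module Defs where

open import Level using (Level; suc; _⊔_)
open import Data.Nat using (ℕ)
open import Data.Fin using (Fin)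
open import Data.Product using (Σ; ∃; _×_; _,_)
open import Data.Sum using (_⊎_)
open import Relation.Nullary using (¬_; Dec)
open import Relation.Binary.PropositionalEquality using (_≡_; _≢_)

record FinitePoset (n : ℕ) : Set₁ where
  field
    _<_      : Fin n → Fin n → Set
    irrefl   : ∀ {x} → ¬ (x < x)
    trans    : ∀ {x y z} → x < y → y < z → x < z
    _<?_     : ∀ x y → Dec (x < y)

module _ {n : ℕ} (P : FinitePoset n) where
  open FinitePoset P

  _≺_ : Fin n → Fin n → Set
  x ≺ y = x < y × (∀ z → x < z → ¬ (z < y))

  Comparable : Fin n → Fin n → Set
  Comparable x y = x ≡ y ⊎ (x < y ⊎ y < x)

  Incomparable : Fin n → Fin n → Set
  Incomparable x y = ¬ Comparable x y

  IsN : Fin n → Fin n → Fin n → Fin n → Set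
  IsN a b c d =
    (a ≢ b × a ≢ c × a ≢ d × b ≢ c × b ≢ d × c ≢ d) ×
    (a ≺ b × c ≺ b × c ≺ d × Incomparable a d)

  NFree : Set
  NFree = ∀ a b c d → ¬ IsN a b c d

  TotallyOrdered : Set
  TotallyOrdered = ∀ x y → Comparable x y

  Minimal : Fin n → Set
  Minimal x = ∀ y → ¬ (y < x)

  Maximal : Fin n → Set
  Maximal x = ∀ y → ¬ (x < y)

  -- y is minimal in P ∖ {x}  (y ≠ x assumed by context)
  MinimalWithout : Fin n → Fin n → Set
  MinimalWithout x y = ∀ z → z ≢ x → ¬ (z < y)

  Autonomous : (Fin n → Set) → Set
  Autonomous A = ∀ v a a' → ¬ A v → A a → A a' →
    (v < a → v < a') × (a < v → a' < v)

module Submission where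

-- Write x ⋖ y for "y is an upper cover of x".  The heart of the
-- argument is a property of covers in N-free orders: if a ⋖ b ≻ c ⋖ d with
-- a ≠ c, then a ⋖ d (otherwise (a,b,c,d) or a nearby 4-tuple is an N).  Hence
-- two distinct minimal elements with a common upper cover have exactly the
-- same strict upper bounds, so together they form an autonomous pair.
--
-- It therefore suffices to find two distinct minimal elements with a common
-- upper cover.  By well-founded induction on y we show: whenever a minimal x
-- is covered by y, such a pair exists.  If some non-minimal element lies
-- below y we descend to a smaller cover of a minimal element; otherwise all
-- elements below y are minimal and covered by y, and the covering hypothesis
-- together with the cover property guarantees one besides x.
--
-- Finally, an incomparable pair x, y exists since P is not a chain; if a
-- minimal element below x or y is not maximal we obtain a cover of a minimal
-- element and apply the claim, and otherwise x and y are isolated points,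
-- which trivially form an autonomous pair of minimal elements.

open import Defs
open import Data.Nat using (ℕ)
open import Data.Fin using (Fin)
open import Data.Fin.Properties using (any?; all?; _≟_; ¬∀⟶∃¬)
open import Data.Fin.Induction using (spo-wellFounded; spo-noetherian)
open import Data.Product using (∃; _×_; _,_; proj₁; proj₂)
open import Data.Sum using (_⊎_; inj₁; inj₂)
open import Data.Empty using (⊥-elim)
open import Function using (id; _∘_; flip)
open import Induction.WellFounded using (Acc; acc; WellFounded)
open import Relation.Nullary using (¬_; Dec; yes; no; ¬?)
open import Relation.Nullary.Decidable using (_×-dec_; _⊎-dec_)
open import Relation.Binary.Structures using (IsStrictPartialOrder)
open import Relation.Binary.PropositionalEquality
  using (_≡_; _≢_; refl; sym; subst; resp₂; isEquivalence)

module OrderFacts {n : ℕ} (P : FinitePoset n) where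
  open FinitePoset P renaming (trans to <-trans)

  _⋖_ : Fin n → Fin n → Set
  x ⋖ y = _≺_ P x y

  _≤_ : Fin n → Fin n → Set
  x ≤ y = x ≡ y ⊎ x < y

  <-≤-trans : ∀ {x y z} → x < y → y ≤ z → x < z
  <-≤-trans x<y (inj₁ refl) = x<y
  <-≤-trans x<y (inj₂ y<z) = <-trans x<y y<z

  ≤-<-trans : ∀ {x y z} → x ≤ y → y < z → x < z
  ≤-<-trans (inj₁ refl) y<z = y<z
  ≤-<-trans (inj₂ x<y) y<z = <-trans x<y y<z

  <⇒≢ : ∀ {x y} → x < y → x ≢ y
  <⇒≢ x<y refl = irrefl x<y

  ≤-minimal : ∀ {z m} → Minimal P m → z ≤ m → z ≡ m
  ≤-minimal mMin (inj₁ z≡m) = z≡m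
  ≤-minimal mMin (inj₂ z<m) = ⊥-elim (mMin _ z<m)

  <-isStrictPartialOrder : IsStrictPartialOrder _≡_ _<_
  <-isStrictPartialOrder = record
    { isEquivalence = isEquivalence
    ; irrefl        = λ { refl → irrefl }
    ; trans         = <-trans
    ; <-resp-≈      = resp₂ _<_
    }

  <-wellFounded : WellFounded _<_
  <-wellFounded = spo-wellFounded <-isStrictPartialOrder

  >-wellFounded : WellFounded (flip _<_)
  >-wellFounded = spo-noetherian <-isStrictPartialOrder

  minimalBelow : ∀ y → ∃ λ m → Minimal P m × m ≤ y
  minimalBelow y = go y (<-wellFounded y)
    where
    go : ∀ y → Acc _<_ y → ∃ λ m → Minimal P m × m ≤ y
    go y (acc below) with any? (_<? y)
    ... | no nothingBelow = y , (λ x x<y → nothingBelow (x , x<y)) , inj₁ refl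
    ... | yes (x , x<y) with go x (below x<y)
    ...   | m , mMin , m≤x = m , mMin , inj₂ (≤-<-trans m≤x x<y)

  coverAbove : ∀ {x y} → x < y → ∃ λ c → x ⋖ c × c ≤ y
  coverAbove {x} {y} = go y (<-wellFounded y)
    where
    go : ∀ y → Acc _<_ y → x < y → ∃ λ c → x ⋖ c × c ≤ y
    go y (acc below) x<y with any? (λ z → (x <? z) ×-dec (z <? y))
    ... | no nothingBetween =
          y , (x<y , λ z x<z z<y → nothingBetween (z , x<z , z<y)) , inj₁ refl
    ... | yes (z , x<z , z<y) with go z (below z<y) x<z
    ...   | c , x⋖c , c≤z = c , x⋖c , inj₂ (≤-<-trans c≤z z<y)

  coverBelow : ∀ {z y} → z < y → ∃ λ c → c ⋖ y × z ≤ c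
  coverBelow {z} {y} = go z (>-wellFounded z)
    where
    go : ∀ z → Acc (flip _<_) z → z < y → ∃ λ c → c ⋖ y × z ≤ c
    go z (acc above) z<y with any? (λ w → (z <? w) ×-dec (w <? y))
    ... | no nothingBetween =
          z , (z<y , λ w z<w w<y → nothingBetween (w , z<w , w<y)) , inj₁ refl
    ... | yes (w , z<w , w<y) with go w (above z<w) w<y
    ...   | c , c⋖y , w≤c = c , c⋖y , inj₂ (<-≤-trans z<w w≤c)

  comparable? : ∀ x y → Dec (Comparable P x y)
  comparable? x y = (x ≟ y) ⊎-dec ((x <? y) ⊎-dec (y <? x))

  incomparablePair : ¬ TotallyOrdered P → ∃ λ x → ∃ λ y → Incomparable P x y
  incomparablePair notTotal with ¬∀⟶∃¬ n (λ x → ∀ y → Comparable P x y)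
                                   (λ x → all? (comparable? x)) notTotal
  ... | x , notTotalAtX with ¬∀⟶∃¬ n (Comparable P x) (comparable? x) notTotalAtX
  ...   | y , x∥y = x , y , x∥y

  AutonomousMinimalPair : Set
  AutonomousMinimalPair = ∃ λ m → ∃ λ m' → m ≢ m' × Minimal P m × Minimal P m' ×
    Autonomous P (λ v → v ≡ m ⊎ v ≡ m')

  -- For minimal m, m' nothing lies below either, so {m, m'} is autonomous
  -- as soon as m and m' have the same strict upper bounds.
  minimalPairAutonomous : ∀ {m m'} → Minimal P m → Minimal P m' →
    (∀ v → m < v → m' < v) → (∀ v → m' < v → m < v) →
    Autonomous P (λ v → v ≡ m ⊎ v ≡ m')
  minimalPairAutonomous mMin m'Min up up' v _ _ _ (inj₁ refl) (inj₁ refl) = id , id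
  minimalPairAutonomous mMin m'Min up up' v _ _ _ (inj₁ refl) (inj₂ refl) =
    (λ v<m → ⊥-elim (mMin v v<m)) , up v
  minimalPairAutonomous mMin m'Min up up' v _ _ _ (inj₂ refl) (inj₁ refl) =
    (λ v<m' → ⊥-elim (m'Min v v<m')) , up' v
  minimalPairAutonomous mMin m'Min up up' v _ _ _ (inj₂ refl) (inj₂ refl) = id , id

  Isolated : Fin n → Set
  Isolated x = Minimal P x × Maximal P x

  isolatedPair : ∀ {x y} → x ≢ y → Isolated x → Isolated y → AutonomousMinimalPair
  isolatedPair x≢y (xMin , xMax) (yMin , yMax) =
    _ , _ , x≢y , xMin , yMin ,
    minimalPairAutonomous xMin yMin (λ v → ⊥-elim ∘ xMax v) (λ v → ⊥-elim ∘ yMax v)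

module NFreeCovers {n : ℕ} (P : FinitePoset n) (nfree : NFree P) where
  open FinitePoset P renaming (trans to <-trans)
  open OrderFacts P

  noN : ∀ {a b c d} → a ⋖ b → c ⋖ b → a ≢ c → c ⋖ d → Comparable P a d
  noN {a} {b} {c} {d} a⋖b c⋖b a≢c c⋖d with comparable? a d
  ... | yes a~d = a~d
  ... | no a∥d = ⊥-elim (nfree a b c d (distinct , a⋖b , c⋖b , c⋖d , a∥d))
    where
    distinct : a ≢ b × a ≢ c × a ≢ d × b ≢ c × b ≢ d × c ≢ d
    distinct =
      <⇒≢ (proj₁ a⋖b) , a≢c , a∥d ∘ inj₁ , <⇒≢ (proj₁ c⋖b) ∘ sym ,
      (λ b≡d → a∥d (inj₂ (inj₁ (subst (a <_) b≡d (proj₁ a⋖b))))) , <⇒≢ (proj₁ c⋖d)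

  sharedUpperCovers : ∀ {a b c d} → a ⋖ b → c ⋖ b → a ≢ c → c ⋖ d → a ⋖ d
  sharedUpperCovers {a} {b} {c} {d} a⋖b c⋖b a≢c c⋖d = a<d , nothingBetween
    where
    -- d ≤ a would put c < d ≤ a < b, contradicting c ⋖ b.
    a<d : a < d
    a<d with noN a⋖b c⋖b a≢c c⋖d
    ... | inj₁ refl = ⊥-elim (proj₂ c⋖b a (proj₁ c⋖d) (proj₁ a⋖b))
    ... | inj₂ (inj₁ a<d) = a<d
    ... | inj₂ (inj₂ d<a) = ⊥-elim (proj₂ c⋖b a (<-trans (proj₁ c⋖d) d<a) (proj₁ a⋖b))

    -- An element z with a < z < d yields a cover a ⋖ a' ≤ z, and then
    -- c ⋖ b ≻ a ⋖ a' forces c, a' to be comparable, which is impossible.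
    nothingBetween : ∀ z → a < z → ¬ (z < d)
    nothingBetween z a<z z<d with coverAbove a<z
    ... | a' , a⋖a' , a'≤z with noN c⋖b a⋖b (a≢c ∘ sym) a⋖a'
    ...   | inj₁ refl = proj₂ a⋖b c (proj₁ a⋖a') (proj₁ c⋖b)
    ...   | inj₂ (inj₁ c<a') = proj₂ c⋖d a' c<a' (≤-<-trans a'≤z z<d)
    ...   | inj₂ (inj₂ a'<c) = proj₂ a⋖b c (<-trans (proj₁ a⋖a') a'<c) (proj₁ c⋖b)

  -- Hence distinct elements with a common upper cover have the same strict
  -- upper bounds: go up from x through a cover d, which y shares.
  siblingsSameUpperBounds : ∀ {x y b v} → x ⋖ b → y ⋖ b → x ≢ y → x < v → y < v
  siblingsSameUpperBounds x⋖b y⋖b x≢y x<v with coverAbove x<v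
  ... | d , x⋖d , d≤v =
        <-≤-trans (proj₁ (sharedUpperCovers y⋖b x⋖b (x≢y ∘ sym) x⋖d)) d≤v

  siblingPair : ∀ {m m' b} → m ≢ m' → Minimal P m → Minimal P m' →
    m ⋖ b → m' ⋖ b → AutonomousMinimalPair
  siblingPair m≢m' mMin m'Min m⋖b m'⋖b =
    _ , _ , m≢m' , mMin , m'Min ,
    minimalPairAutonomous mMin m'Min
      (λ v → siblingsSameUpperBounds m⋖b m'⋖b m≢m')
      (λ v → siblingsSameUpperBounds m'⋖b m⋖b (m≢m' ∘ sym))

module CoveringHypothesis {n : ℕ} (P : FinitePoset n) (nfree : NFree P)
    (covering : ∀ x → Minimal P x →
      Maximal P x ⊎ ∃ λ y → _≺_ P x y × ¬ MinimalWithout P x y) where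
  open FinitePoset P
  open OrderFacts P
  open NFreeCovers P nfree

  -- Every upper cover y of a minimal element x lies above a second element:
  -- the hypothesis gives a cover y' of x above some z ≠ x; a lower cover z'
  -- of y' above z differs from x, so it shares the cover y with x.
  secondElementBelow : ∀ {x y} → Minimal P x → x ⋖ y → ∃ λ z → z < y × z ≢ x
  secondElementBelow {x} {y} xMin x⋖y with covering x xMin
  ... | inj₁ xMax = ⊥-elim (xMax y (proj₁ x⋖y))
  ... | inj₂ (y' , x⋖y' , notMinimalWithout)
        with any? (λ z → ¬? (z ≟ x) ×-dec (z <? y'))
  ...   | no noOther = ⊥-elim (notMinimalWithout λ z z≢x z<y' → noOther (z , z≢x , z<y'))
  ...   | yes (z , z≢x , z<y') with coverBelow z<y'
  ...     | z' , z'⋖y' , z≤z' = z' , proj₁ (sharedUpperCovers z'⋖y' x⋖y' z'≢x x⋖y) , z'≢x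
    where
    z'≢x : z' ≢ x
    z'≢x z'≡x = z≢x (≤-minimal xMin (subst (z ≤_) z'≡x z≤z'))

  pairFromCover : ∀ {x y} → Minimal P x → x ⋖ y → AutonomousMinimalPair
  pairFromCover {y = y} = go y (<-wellFounded y)
    where
    go : ∀ y → Acc _<_ y → ∀ {x} → Minimal P x → x ⋖ y → AutonomousMinimalPair
    go y (acc below) xMin x⋖y
      with any? (λ z → any? (_<? z) ×-dec (z <? y))
    -- A non-minimal z < y lies above a cover m ⋖ c ≤ z of a minimal m.
    ... | yes (z , (w , w<z) , z<y) with minimalBelow w
    ...   | m , mMin , m≤w with coverAbove (≤-<-trans m≤w w<z)
    ...     | c , m⋖c , c≤z = go c (below (≤-<-trans c≤z z<y)) mMin m⋖c
    -- Otherwise everything below y is minimal and covered by y.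
    go y (acc below) {x} xMin x⋖y | no allMinimal with secondElementBelow xMin x⋖y
    ... | z , z<y , z≢x = siblingPair (z≢x ∘ sym) xMin zMin x⋖y z⋖y
      where
      zMin : Minimal P z
      zMin w w<z = allMinimal (z , (w , w<z) , z<y)

      z⋖y : z ⋖ y
      z⋖y = z<y , λ t z<t t<y → allMinimal (t , (z , z<t) , t<y)

  -- Every element is isolated, unless the claim applies to a minimal
  -- element below it which is not maximal.
  isolatedOrPair : ∀ z → Isolated z ⊎ AutonomousMinimalPair
  isolatedOrPair z with minimalBelow z
  ... | m , mMin , m≤z with any? (m <?_)
  ...   | yes (t , m<t) = inj₂ (pairFromCover mMin (proj₁ (proj₂ (coverAbove m<t))))
  ...   | no nothingAbove with m≤z
  ...     | inj₁ refl = inj₁ (mMin , λ t m<t → nothingAbove (t , m<t))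
  ...     | inj₂ m<z = ⊥-elim (nothingAbove (z , m<z))

mainTheorem5 : (n : ℕ) (P : FinitePoset n) →
    NFree P →
    ¬ TotallyOrdered P →
    (∀ x → Minimal P x →
    Maximal P x ⊎ ∃ λ y → _≺_ P x y × ¬ MinimalWithout P x y) →
    ∃ λ m → ∃ λ m' → m ≢ m' × Minimal P m × Minimal P m' ×
    Autonomous P (λ v → v ≡ m ⊎ v ≡ m')
mainTheorem5 n P nfree notTotal covering
  with OrderFacts.incomparablePair P notTotal
... | x , y , x∥y
  with CoveringHypothesis.isolatedOrPair P nfree covering x
     | CoveringHypothesis.isolatedOrPair P nfree covering y
... | inj₂ pair | _ = pair
... | inj₁ _ | inj₂ pair = pair
... | inj₁ xIsolated | inj₁ yIsolated =
      OrderFacts.isolatedPair P (x∥y ∘ inj₁) xIsolated yIsolated
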